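{- Let $n \geq 2$ be an integer and let $\Upsilon'_n$ be the simple undirected graph whose vertices are the proper divisors of $n$, two distinct vertices $k_i, k_j$ being adjacent if and only if $k_i \nmid k_j$ and $k_j \nmid k_i$. Then $\Upsilon'_n$ is connected if and only if $n$ is not of the form $p^t$ for a prime $p$ and a natural number $t \geq 3$.
   Context: A proper divisor of $n$ is an integer $k$ with $k \mid n$ and $1 < k < n$. When $n$ is prime, $\Upsilon'_n$ has no vertices; this case is regarded as trivially connected (as the paper does). -}

module Defs where

open import Data.Nat using (ℕ; _<_; _≤_; _^_)
open import Data.Nat.Divisibility using (_∣_)
open import Data.Nat.Primality using (Prime)
open import Data.Product using (Σ; ∃; _×_; proj₁)
open import Relation.Nullary using (¬_)
open import Relation.Binary.PropositionalEquality using (_≡_; _≢_)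
open import Relation.Binary.Construct.Closure.ReflexiveTransitive using (Star)

ProperDivisor : ℕ → ℕ → Set
ProperDivisor n k = k ∣ n × 1 < k × k < n

Vertex : ℕ → Set
Vertex n = Σ ℕ (ProperDivisor n)

Adj : (n : ℕ) → Vertex n → Vertex n → Set
Adj n u v = proj₁ u ≢ proj₁ v × ¬ (proj₁ u ∣ proj₁ v) × ¬ (proj₁ v ∣ proj₁ u)

-- connected: every pair of vertices is joined by a walk (vacuous when no vertices)
Connected : ℕ → Set
Connected n = (u v : Vertex n) → Star (Adj n) u v

PrimePowerAtLeast3 : ℕ → Set
PrimePowerAtLeast3 n = ∃ λ p → ∃ λ t → Prime p × 3 ≤ t × n ≡ p ^ t

{-# OPTIONS --safe #-}
module Submission where

-- If n = p^t, every proper divisor is a power of p, so any two are comparable: the graph has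
-- no edges, and for t ≥ 3 it has the two vertices p and p². Otherwise either n = p or n = p²,
-- with at most one vertex, or n = A * B with A = p^a and B coprime, both proper. In the last
-- case every vertex k is joined to A within two steps: k is incomparable with A, or else
-- incomparable with B, and B is incomparable with A.

open import Defs
open import Data.Nat
open import Data.Nat.Properties
open import Data.Nat.Divisibility
open import Data.Nat.Primality using (Prime; prime⇒irreducible; prime⇒nonTrivial)
open import Data.Nat.Primality.Factorisation using (factorise)
open import Data.Nat.Coprimality using (Coprime; coprime-divisor)
open import Data.Nat.Induction using (<-rec)
open import Data.List using ([]; _∷_)
open import Data.List.Relation.Unary.All using (_∷_)
open import Data.Product using (∃; ∃₂; _×_; _,_; proj₁)
open import Data.Sum using (inj₁; inj₂)
open import Data.Empty using (⊥-elim)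
open import Relation.Nullary using (¬_; yes; no)
open import Relation.Binary.PropositionalEquality
open import Relation.Binary.Construct.Closure.ReflexiveTransitive using (Star; ε; _◅_; _◅◅_; reverse)
open import Function.Bundles using (_⇔_; mk⇔)

∣-irrelevant : ∀ {m n} .{{_ : NonZero m}} (x y : m ∣ n) → x ≡ y
∣-irrelevant {m} (divides q eq) (divides q′ eq′) with *-cancelʳ-≡ q q′ m (trans (sym eq) eq′)
... | refl = cong (divides q) (≡-irrelevant eq eq′)

vertex-≡ : ∀ {n} {u v : Vertex n} → proj₁ u ≡ proj₁ v → u ≡ v
vertex-≡ {u = k , k∣n , 1<k , k<n} {v = .k , k∣n′ , 1<k′ , k<n′} refl
  rewrite ∣-irrelevant {{>-nonZero (<-trans z<s 1<k)}} k∣n k∣n′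
        | ≤-irrelevant 1<k 1<k′ | ≤-irrelevant k<n k<n′ = refl

divisorVertex : ∀ {n k} → k ∣ n → 1 < k → k < n → Vertex n
divisorVertex {k = k} k∣n 1<k k<n = k , k∣n , 1<k , k<n

Adj-sym : ∀ {n} {u v : Vertex n} → Adj n u v → Adj n v u
Adj-sym (u≢v , u∤v , v∤u) = (λ v≡u → u≢v (sym v≡u)) , v∤u , u∤v

incomparable⇒Adj : ∀ {n} (u v : Vertex n) → proj₁ u ∤ proj₁ v → proj₁ v ∤ proj₁ u → Adj n u v
incomparable⇒Adj _ _ u∤v v∤u = (λ u≡v → u∤v (∣-reflexive u≡v)) , u∤v , v∤u

edge : ∀ {n} (u v : Vertex n) → Adj n u v → Star (Adj n) u v
edge _ v u~v = _◅_ {j = v} u~v ε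

walk-reverse : ∀ {n} {u v : Vertex n} → Star (Adj n) u v → Star (Adj n) v u
walk-reverse {n} = reverse (λ {u} {v} → Adj-sym {n} {u} {v})

hub⇒Connected : ∀ {n} (h : Vertex n) → (∀ u → Star (Adj n) u h) → Connected n
hub⇒Connected h reach u v = reach u ◅◅ walk-reverse (reach v)

walk-edgeless : ∀ {n} → (∀ u v → ¬ Adj n u v) → {u v : Vertex n} → Star (Adj n) u v → u ≡ v
walk-edgeless edgeless ε                           = refl
walk-edgeless edgeless {u} (_◅_ {j = v} u~v _) = ⊥-elim (edgeless u v u~v)

uniqueDivisor⇒Connected : ∀ {n} → (∀ (u v : Vertex n) → proj₁ u ≡ proj₁ v) → Connected n
uniqueDivisor⇒Connected same u v = subst (Star _ u) (vertex-≡ (same u v)) ε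

module CoprimeFactors {n A B : ℕ} (A*B≡n : A * B ≡ n) (1<A : 1 < A) (1<B : 1 < B)
                      (coprime : Coprime A B) where

  instance
    A≢0 : NonZero A
    A≢0 = >-nonZero (<-trans z<s 1<A)
    B≢0 : NonZero B
    B≢0 = >-nonZero (<-trans z<s 1<B)

  A∤B : A ∤ B
  A∤B A∣B = <⇒≢ 1<A (sym (coprime (∣-refl , A∣B)))

  B∤A : B ∤ A
  B∤A B∣A = <⇒≢ 1<B (sym (coprime (B∣A , ∣-refl)))

  both∣⇒n∣ : ∀ {k} → A ∣ k → B ∣ k → n ∣ k
  both∣⇒n∣ {k} (divides q refl) B∣q*A = subst (_∣ q * A) A*B≡n A*B∣q*A
    where
    B∣q : B ∣ q
    B∣q = coprime-divisor (λ (x∣B , x∣A) → coprime (x∣A , x∣B)) (subst (B ∣_) (*-comm q A) B∣q*A)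
    A*B∣q*A : A * B ∣ q * A
    A*B∣q*A = subst (A * B ∣_) (*-comm A q) (*-monoʳ-∣ A B∣q)

  vA : Vertex n
  vA = divisorVertex (divides B (trans (sym A*B≡n) (*-comm A B))) 1<A
                     (subst (A <_) A*B≡n (m<m*n A B 1<B))

  vB : Vertex n
  vB = divisorVertex (divides A (sym A*B≡n)) 1<B
                     (subst (B <_) (trans (*-comm B A) A*B≡n) (m<m*n B A 1<A))

  vB⇝vA : Star (Adj n) vB vA
  vB⇝vA = edge vB vA (incomparable⇒Adj vB vA B∤A A∤B)

  reaches-vA : ∀ u → Star (Adj n) u vA
  reaches-vA u@(k , _ , 1<k , k<n) with A ∣? k | k ∣? A
  ... | no A∤k | no k∤A = edge u vA (incomparable⇒Adj u vA k∤A A∤k)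
  ... | yes A∣k | _ = edge u vB (incomparable⇒Adj u vB k∤B B∤k) ◅◅ vB⇝vA
    where
    B∤k : B ∤ k
    B∤k B∣k = <⇒≱ k<n (∣⇒≤ {{>-nonZero (<-trans z<s 1<k)}} (both∣⇒n∣ A∣k B∣k))
    k∤B : k ∤ B
    k∤B k∣B = A∤B (∣-trans A∣k k∣B)
  ... | no _ | yes k∣A = edge u vB (incomparable⇒Adj u vB k∤B B∤k) ◅◅ vB⇝vA
    where
    k∤B : k ∤ B
    k∤B k∣B = <⇒≢ 1<k (sym (coprime (k∣A , k∣B)))
    B∤k : B ∤ k
    B∤k B∣k = B∤A (∣-trans B∣k k∣A)

  connected : Connected n
  connected = hub⇒Connected vA reaches-vA

module PrimePowers {p : ℕ} (prime : Prime p) where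

  instance
    p≢0 : NonZero p
    p≢0 = nonTrivial⇒nonZero p {{prime⇒nonTrivial prime}}

  1<p : 1 < p
  1<p = nonTrivial⇒n>1 p {{prime⇒nonTrivial prime}}

  ^-monoʳ-∣ : ∀ {i j} → i ≤ j → p ^ i ∣ p ^ j
  ^-monoʳ-∣ {j = j} z≤n = 1∣ (p ^ j)
  ^-monoʳ-∣ (s≤s i≤j) = *-monoʳ-∣ p (^-monoʳ-∣ i≤j)

  ^-cancelʳ-< : ∀ {i j} → p ^ i < p ^ j → i < j
  ^-cancelʳ-< p^i<p^j = ≰⇒> (λ j≤i → <⇒≱ p^i<p^j (^-monoʳ-≤ p j≤i))

  ∤⇒coprime : ∀ {d} → p ∤ d → Coprime d p
  ∤⇒coprime p∤d (c∣d , c∣p) with prime⇒irreducible prime c∣p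
  ... | inj₁ c≡1 = c≡1
  ... | inj₂ refl = ⊥-elim (p∤d c∣d)

  ∣^⇒≡^ : ∀ t {d} → d ∣ p ^ t → ∃ λ i → d ≡ p ^ i
  ∣^⇒≡^ zero d∣1 = 0 , ∣1⇒≡1 d∣1
  ∣^⇒≡^ (suc t) {d} d∣p^t+1 with p ∣? d
  ... | no p∤d = ∣^⇒≡^ t (coprime-divisor (∤⇒coprime p∤d) d∣p^t+1)
  ... | yes (divides q refl) with ∣^⇒≡^ t {q} (*-cancelʳ-∣ p (subst (q * p ∣_) (*-comm p (p ^ t)) d∣p^t+1))
  ...   | i , refl = suc i , *-comm (p ^ i) p

  properDivisor⇒≡^ : ∀ {t k} → ProperDivisor (p ^ t) k → ∃ λ i → 0 < i × i < t × k ≡ p ^ i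
  properDivisor⇒≡^ {t} (k∣p^t , 1<k , k<p^t) with ∣^⇒≡^ t k∣p^t
  ... | zero  , refl = ⊥-elim (<-irrefl refl 1<k)
  ... | suc i , refl = suc i , z<s , ^-cancelʳ-< k<p^t , refl

  prime-power-edgeless : ∀ {t} (u v : Vertex (p ^ t)) → ¬ Adj (p ^ t) u v
  prime-power-edgeless {t} (_ , u∣p^t , _) (_ , v∣p^t , _) (_ , u∤v , v∤u)
    with ∣^⇒≡^ t u∣p^t | ∣^⇒≡^ t v∣p^t
  ... | i , refl | j , refl with ≤-total i j
  ...   | inj₁ i≤j = u∤v (^-monoʳ-∣ i≤j)
  ...   | inj₂ j≤i = v∤u (^-monoʳ-∣ j≤i)

  ^-vertex : ∀ {i t} → 0 < i → i < t → Vertex (p ^ t)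
  ^-vertex i>0 i<t = divisorVertex (^-monoʳ-∣ (<⇒≤ i<t)) (^-monoʳ-< p 1<p i>0) (^-monoʳ-< p 1<p i<t)

  ¬connected : ∀ {t} → 3 ≤ t → ¬ Connected (p ^ t)
  ¬connected {t} 3≤t connected = <⇒≢ p<p² (cong proj₁ (walk-edgeless (prime-power-edgeless {t}) walk))
    where
    p<p² : p ^ 1 < p ^ 2
    p<p² = ^-monoʳ-< p 1<p {1} {2} (s≤s (s≤s z≤n))
    walk : Star _ (^-vertex {1} z<s (≤-trans (s≤s (s≤s z≤n)) 3≤t))
                  (^-vertex {2} z<s 3≤t)
    walk = connected _ _

  connected-≤2 : ∀ {t} → t ≤ 2 → Connected (p ^ t)
  connected-≤2 t≤2 = uniqueDivisor⇒Connected λ u v → trans (≡p u) (sym (≡p v))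
    where
    ≡p : ∀ (u : Vertex _) → proj₁ u ≡ p ^ 1
    ≡p (_ , k-proper) with properDivisor⇒≡^ k-proper
    ... | suc zero , _ , _ , k≡p = k≡p
    ... | suc (suc _) , _ , i<t , _ = ⊥-elim (<⇒≱ i<t (≤-trans t≤2 (s≤s (s≤s z≤n))))

  factor-out : ∀ n → 0 < n → ∃₂ λ a m → n ≡ p ^ a * m × p ∤ m
  factor-out = <-rec _ go
    where
    go : ∀ n → (∀ {q} → q < n → 0 < q → ∃₂ λ a m → q ≡ p ^ a * m × p ∤ m) →
         0 < n → ∃₂ λ a m → n ≡ p ^ a * m × p ∤ m
    go n rec n>0 with p ∣? n
    ... | no p∤n = 0 , n , sym (*-identityˡ n) , p∤n
    ... | yes (divides zero refl) = ⊥-elim (<-irrefl refl n>0)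
    ... | yes (divides q@(suc _) refl) with rec (m<m*n q p 1<p) z<s
    ...   | a , m , q≡p^a*m , p∤m = suc a , m , q*p≡p^a+1*m , p∤m
      where
      open ≡-Reasoning
      q*p≡p^a+1*m : q * p ≡ p * p ^ a * m
      q*p≡p^a+1*m = begin
        q * p             ≡⟨ *-comm q p ⟩
        p * q             ≡⟨ cong (p *_) q≡p^a*m ⟩
        p * (p ^ a * m)   ≡⟨ *-assoc p (p ^ a) m ⟨
        p * p ^ a * m     ∎

  ∤⇒coprime-^ : ∀ a {m} → p ∤ m → Coprime (p ^ a) m
  ∤⇒coprime-^ a p∤m (c∣p^a , c∣m) with ∣^⇒≡^ a c∣p^a
  ... | zero  , refl = refl
  ... | suc i , refl = ⊥-elim (p∤m (∣-trans (m∣m*n (p ^ i)) c∣m))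

prime-divisor : ∀ {n} → 2 ≤ n → ∃ λ p → Prime p × p ∣ n
prime-divisor {n@(suc _)} 2≤n with factorise n
... | record { factors = [] ; isFactorisation = n≡1 } = ⊥-elim (<⇒≢ 2≤n (sym n≡1))
... | record { factors = p ∷ ps ; isFactorisation = n≡p*ps ; factorsPrime = p-prime ∷ _ } =
  p , p-prime , subst (p ∣_) (sym n≡p*ps) (m∣m*n _)

connected-unless-prime-power : ∀ {n} → 2 ≤ n → ¬ PrimePowerAtLeast3 n → Connected n
connected-unless-prime-power {n} 2≤n not-power with prime-divisor 2≤n
... | p , p-prime , p∣n with PrimePowers.factor-out p-prime n (<-trans z<s 2≤n)
...   | a , 0 , n≡p^a*0 , _ = ⊥-elim (<⇒≢ (<-trans z<s 2≤n) (sym (trans n≡p^a*0 (*-zeroʳ (p ^ a)))))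
...   | a , 1 , n≡p^a*1 , _ = subst Connected (sym n≡p^a) (PrimePowers.connected-≤2 p-prime a≤2)
  where
  n≡p^a : n ≡ p ^ a
  n≡p^a = trans n≡p^a*1 (*-identityʳ (p ^ a))
  a≤2 : a ≤ 2
  a≤2 = ≤-pred (≰⇒> λ 3≤a → not-power (p , a , p-prime , 3≤a , n≡p^a))
...   | a , m@(suc (suc _)) , n≡p^a*m , p∤m =
  CoprimeFactors.connected (sym n≡p^a*m) (1<p^a a n≡p^a*m) (s≤s (s≤s z≤n))
                           (PrimePowers.∤⇒coprime-^ p-prime a p∤m)
  where
  1<p^a : ∀ b → n ≡ p ^ b * m → 1 < p ^ b
  1<p^a zero    n≡m = ⊥-elim (p∤m (subst (p ∣_) (trans n≡m (*-identityˡ m)) p∣n))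
  1<p^a (suc b) _   = ^-monoʳ-< p (PrimePowers.1<p p-prime) {0} {suc b} z<s

mainTheorem3 : (n : ℕ) → 2 ≤ n → (Connected n ⇔ (¬ PrimePowerAtLeast3 n))
mainTheorem3 n 2≤n = mk⇔ disconnected (connected-unless-prime-power 2≤n)
  where
  disconnected : Connected n → ¬ PrimePowerAtLeast3 n
  disconnected connected (p , t , p-prime , 3≤t , refl) = PrimePowers.¬connected p-prime 3≤t connected
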